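{- The axiom schema $(\mathrm{A_{M8}})$: $(\epsilon ab\wedge\epsilon cd)\supset(\epsilon aa\wedge\epsilon cc\wedge(\epsilon bc\supset(\epsilon ad\wedge\epsilon ba)))$ is nontrivial with respect to $(\mathrm{A_t})$: $\epsilon ab\supset(\epsilon aa\wedge(\epsilon bc\supset(\epsilon ac\wedge\epsilon ba)))$.
   Context: Formulas are built from atomic formulas $\epsilon xy$ ($x,y$ name variables) with classical connectives; an axiom schema is such a formula whose name variables are treated as meta-variables. A formula is an instance of a tautology if it is obtained from a classical propositional tautology by uniformly substituting formulas for propositional variables (equivalently, it is a tautology when distinct atomic formulas $\epsilon xy$ are treated as distinct propositional atoms). For a schema $A$, $nv(A)$ is the tuple of distinct name variables occurring in $A$ ordered by first occurrence from the left, and $\#nv(A)$ its length. A uniform substitution $\sigma$ simultaneously replaces specified name variables by specified name variables. Definition: a schema $A$ with $nv(A)=(x_1,\dots,x_n)$, $n\ge 3$, is trivial with respect to $(\mathrm{A_t})$ if there exist a permutation $\rho$ of $\{1,\dots,n\}$ and mutually distinct name variables $y_1,\dots,y_{n-3}$, none of which is among $x_1,\dots,x_n$ or $a,b,c$, such that for the uniform substitution $\sigma$ replacing $x_{\rho(1)},x_{\rho(2)},x_{\rho(3)}$ by $a,b,c$ and $x_{\rho(3+j)}$ by $y_j$ ($1\le j\le n-3$), the formula $\sigma(A)\equiv(\mathrm{A_t})$ is an instance of a tautology. $A$ is nontrivial with respect to $(\mathrm{A_t})$ if it is not trivial with respect to $(\mathrm{A_t})$. -}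

module Defs where

open import Data.Nat using (ℕ; zero; suc; _<_; _≤_; _∸_)
open import Data.Nat.Properties using (_≟_)
open import Data.Bool using (Bool; true; false; not; _∧_; _∨_)
open import Data.List using (List; []; _∷_; _++_; length; lookup; deduplicate)
open import Data.List.Membership.Propositional using (_∉_)
open import Data.Fin using (Fin; toℕ)
open import Data.Fin.Permutation using (Permutation′; _⟨$⟩ʳ_)
open import Data.Product using (Σ; _×_)
open import Relation.Binary.PropositionalEquality using (_≡_; _≢_)
open import Relation.Nullary using (¬_)

Name : Set
Name = ℕ

a b c d : Name
a = 0
b = 1
c = 2
d = 3

infixr 4 _⊃_ _⇔_
infixr 5 _∨'_
infixr 6 _∧'_
data Fm : Set where
  ε    : Name → Name → Fm
  ⊥'   : Fm
  ¬'_  : Fm → Fm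
  _∧'_ : Fm → Fm → Fm
  _∨'_ : Fm → Fm → Fm
  _⊃_  : Fm → Fm → Fm
  _⇔_  : Fm → Fm → Fm

-- Evaluation under a valuation assigning a truth value to each atom ε x y
-- (distinct atoms are independent propositional atoms).
_⇒ᵇ_ : Bool → Bool → Bool
p ⇒ᵇ q = not p ∨ q

_⇔ᵇ_ : Bool → Bool → Bool
true  ⇔ᵇ q = q
false ⇔ᵇ q = not q

⟦_⟧ : Fm → (Name → Name → Bool) → Bool
⟦ ε x y ⟧ v = v x y
⟦ ⊥' ⟧ v = false
⟦ ¬' A ⟧ v = not (⟦ A ⟧ v)
⟦ A ∧' B ⟧ v = ⟦ A ⟧ v ∧ ⟦ B ⟧ v
⟦ A ∨' B ⟧ v = ⟦ A ⟧ v ∨ ⟦ B ⟧ v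
⟦ A ⊃ B ⟧ v = ⟦ A ⟧ v ⇒ᵇ ⟦ B ⟧ v
⟦ A ⇔ B ⟧ v = ⟦ A ⟧ v ⇔ᵇ ⟦ B ⟧ v

TautInstance : Fm → Set
TautInstance A = ∀ (v : Name → Name → Bool) → ⟦ A ⟧ v ≡ true

substF : (Name → Name) → Fm → Fm
substF σ (ε x y) = ε (σ x) (σ y)
substF σ ⊥' = ⊥'
substF σ (¬' A) = ¬' substF σ A
substF σ (A ∧' B) = substF σ A ∧' substF σ B
substF σ (A ∨' B) = substF σ A ∨' substF σ B
substF σ (A ⊃ B) = substF σ A ⊃ substF σ B
substF σ (A ⇔ B) = substF σ A ⇔ substF σ B

occ : Fm → List Name
occ (ε x y) = x ∷ y ∷ []
occ ⊥' = []
occ (¬' A) = occ A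
occ (A ∧' B) = occ A ++ occ B
occ (A ∨' B) = occ A ++ occ B
occ (A ⊃ B) = occ A ++ occ B
occ (A ⇔ B) = occ A ++ occ B

nv : Fm → List Name
nv A = deduplicate _≟_ (occ A)

target : (ℕ → Name) → ℕ → Name
target y 0 = a
target y 1 = b
target y 2 = c
target y (suc (suc (suc j))) = y j

Trivial : Fm → Fm → Set
Trivial A At =
  3 ≤ length (nv A) ×
  Σ (Permutation′ (length (nv A))) λ ρ →
  Σ (ℕ → Name) λ y →
    (∀ j k → j < length (nv A) ∸ 3 → k < length (nv A) ∸ 3 → y j ≡ y k → j ≡ k) ×
    (∀ j → j < length (nv A) ∸ 3 →
       y j ∉ nv A × y j ≢ a × y j ≢ b × y j ≢ c) ×
    Σ (Name → Name) λ σ →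
      (∀ (k : Fin (length (nv A))) →
         σ (lookup (nv A) (ρ ⟨$⟩ʳ k)) ≡ target y (toℕ k)) ×
      TautInstance (substF σ A ⇔ At)

Nontrivial : Fm → Fm → Set
Nontrivial A At = ¬ Trivial A At

A-M8 : Fm
A-M8 = (ε a b ∧' ε c d) ⊃ (ε a a ∧' (ε c c ∧' (ε b c ⊃ (ε a d ∧' ε b a))))

A-t : Fm
A-t = ε a b ⊃ (ε a a ∧' (ε b c ⊃ (ε a c ∧' ε b a)))

-- A triviality witness σ is injective on the name variables a, b, c, d of (A_M8),
-- so σa and σc are not both a; let s be one of them that is not. The valuation
-- in which εss is the only false atom refutes σ(A_M8), whose antecedent
-- εσaσb ∧ εσcσd stays true while its consequent demands εσaσa ∧ εσcσc, yet it
-- satisfies (A_t), since the atoms εaa, εac, εba on which (A_t) depends all mention a.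
module Submission where

open import Defs
open import Data.Bool using (Bool; true; false; not; _∧_)
open import Data.Bool.Properties using (∧-zeroʳ; ∨-zeroʳ)
open import Data.Empty using (⊥-elim)
open import Data.Fin using (Fin; toℕ; #_)
open import Data.Fin.Permutation using (Permutation′; _⟨$⟩ʳ_; _⟨$⟩ˡ_; inverseʳ)
open import Data.Fin.Properties using (toℕ<n; toℕ-injective)
open import Data.List using (lookup)
open import Data.Nat using (ℕ; suc; _<_; _∸_; s≤s)
open import Data.Nat.Properties using (_≟_)
open import Data.Product using (Σ; _×_; _,_; proj₁; proj₂)
open import Data.Sum using (_⊎_; inj₁; inj₂)
open import Function using (_∘_)
open import Function.Definitions using (Injective)
open import Relation.Binary.PropositionalEquality
open import Relation.Nullary using (¬_; does; yes; no)
open import Relation.Nullary.Decidable using (dec-true; dec-false)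

target-injective : ∀ {n} (y : ℕ → Name) →
  (∀ j k → j < n ∸ 3 → k < n ∸ 3 → y j ≡ y k → j ≡ k) →
  (∀ j → j < n ∸ 3 → y j ≢ a × y j ≢ b × y j ≢ c) →
  Injective _≡_ _≡_ (λ (k : Fin n) → target y (toℕ k))
target-injective {n} y y-injective y-fresh {i} {k} e =
  toℕ-injective (go (toℕ i) (toℕ k) (toℕ<n i) (toℕ<n k) e)
  where
  go : ∀ i k → i < n → k < n → target y i ≡ target y k → i ≡ k
  go 0 0 _ _ _ = refl
  go 1 1 _ _ _ = refl
  go 2 2 _ _ _ = refl
  go (suc (suc (suc i))) (suc (suc (suc k))) (s≤s (s≤s (s≤s p))) (s≤s (s≤s (s≤s q))) e =
    cong (suc ∘ suc ∘ suc) (y-injective i k p q e)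
  go 0 1 _ _ ()
  go 0 2 _ _ ()
  go 1 0 _ _ ()
  go 1 2 _ _ ()
  go 2 0 _ _ ()
  go 2 1 _ _ ()
  go 0 (suc (suc (suc k))) _ (s≤s (s≤s (s≤s q))) e = ⊥-elim (proj₁ (y-fresh k q) (sym e))
  go 1 (suc (suc (suc k))) _ (s≤s (s≤s (s≤s q))) e = ⊥-elim (proj₁ (proj₂ (y-fresh k q)) (sym e))
  go 2 (suc (suc (suc k))) _ (s≤s (s≤s (s≤s q))) e = ⊥-elim (proj₂ (proj₂ (y-fresh k q)) (sym e))
  go (suc (suc (suc i))) 0 (s≤s (s≤s (s≤s p))) _ e = ⊥-elim (proj₁ (y-fresh i p) e)
  go (suc (suc (suc i))) 1 (s≤s (s≤s (s≤s p))) _ e = ⊥-elim (proj₁ (proj₂ (y-fresh i p)) e)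
  go (suc (suc (suc i))) 2 (s≤s (s≤s (s≤s p))) _ e = ⊥-elim (proj₂ (proj₂ (y-fresh i p)) e)

injective-via-permutation : ∀ {n} {B : Set} (ρ : Permutation′ n) (f g : Fin n → B) →
  (∀ k → f (ρ ⟨$⟩ʳ k) ≡ g k) → Injective _≡_ _≡_ g → Injective _≡_ _≡_ f
injective-via-permutation ρ f g f∘ρ≗g g-injective {i} {j} fi≡fj = begin
  i                      ≡⟨ inverseʳ ρ ⟨
  ρ ⟨$⟩ʳ (ρ ⟨$⟩ˡ i)      ≡⟨ cong (ρ ⟨$⟩ʳ_) (g-injective g∘ρˡi≡g∘ρˡj) ⟩
  ρ ⟨$⟩ʳ (ρ ⟨$⟩ˡ j)      ≡⟨ inverseʳ ρ ⟩
  j                      ∎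
  where
  open ≡-Reasoning
  f≗g∘ρˡ : ∀ i → f i ≡ g (ρ ⟨$⟩ˡ i)
  f≗g∘ρˡ i = trans (cong f (sym (inverseʳ ρ))) (f∘ρ≗g (ρ ⟨$⟩ˡ i))
  g∘ρˡi≡g∘ρˡj : g (ρ ⟨$⟩ˡ i) ≡ g (ρ ⟨$⟩ˡ j)
  g∘ρˡi≡g∘ρˡj = trans (sym (f≗g∘ρˡ i)) (trans fi≡fj (f≗g∘ρˡ j))

trueExcept : Name → Name → Name → Name → Bool
trueExcept p q x y = not (does (x ≟ p) ∧ does (y ≟ q))

trueExcept-self : ∀ p q → trueExcept p q p q ≡ false
trueExcept-self p q rewrite dec-true (p ≟ p) refl | dec-true (q ≟ q) refl = refl

trueExcept-≢ˡ : ∀ {p q x} y → x ≢ p → trueExcept p q x y ≡ true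
trueExcept-≢ˡ {p} {x = x} y x≢p rewrite dec-false (x ≟ p) x≢p = refl

trueExcept-≢ʳ : ∀ {p q y} x → y ≢ q → trueExcept p q x y ≡ true
trueExcept-≢ʳ {p} {q} {y} x y≢q
  rewrite dec-false (y ≟ q) y≢q | ∧-zeroʳ (does (x ≟ p)) = refl

A-t-holds : ∀ v → v a a ≡ true → v a c ≡ true → v b a ≡ true → ⟦ A-t ⟧ v ≡ true
A-t-holds v aa ac ba rewrite aa | ac | ba | ∨-zeroʳ (not (v b c)) = ∨-zeroʳ (not (v a b))

A-t-holds-off-a : ∀ {p q} → p ≢ a → q ≢ a → ⟦ A-t ⟧ (trueExcept p q) ≡ true
A-t-holds-off-a {p} {q} p≢a q≢a = A-t-holds (trueExcept p q)
  (trueExcept-≢ˡ {p} {q} a (p≢a ∘ sym)) (trueExcept-≢ˡ {p} {q} c (p≢a ∘ sym))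
  (trueExcept-≢ʳ {p} {q} b (q≢a ∘ sym))

A-M8-instance-fails : ∀ σ v → v (σ a) (σ b) ≡ true → v (σ c) (σ d) ≡ true →
  v (σ a) (σ a) ≡ false ⊎ v (σ c) (σ c) ≡ false → ⟦ substF σ A-M8 ⟧ v ≡ false
A-M8-instance-fails σ v ab cd (inj₁ aa) rewrite ab | cd | aa = refl
A-M8-instance-fails σ v ab cd (inj₂ cc) rewrite ab | cd | cc = ∧-zeroʳ (v (σ a) (σ a))

A-M8-instance-refutable : ∀ σ → σ b ≢ σ a → σ c ≢ σ a → σ d ≢ σ c →
  Σ Name λ s → s ≢ a × ⟦ substF σ A-M8 ⟧ (trueExcept s s) ≡ false
A-M8-instance-refutable σ σb≢σa σc≢σa σd≢σc with σ a ≟ a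
... | no σa≢a = σ a , σa≢a ,
  A-M8-instance-fails σ (trueExcept (σ a) (σ a))
    (trueExcept-≢ʳ (σ a) σb≢σa) (trueExcept-≢ˡ (σ d) σc≢σa)
    (inj₁ (trueExcept-self (σ a) (σ a)))
... | yes σa≡a = σ c , (λ σc≡a → σc≢σa (trans σc≡a (sym σa≡a))) ,
  A-M8-instance-fails σ (trueExcept (σ c) (σ c))
    (trueExcept-≢ˡ (σ b) (σc≢σa ∘ sym)) (trueExcept-≢ʳ (σ c) σd≢σc)
    (inj₂ (trueExcept-self (σ c) (σ c)))

separated⇒¬TautInstance : ∀ {A B : Fm} v →
  ⟦ A ⟧ v ≡ false → ⟦ B ⟧ v ≡ true → ¬ TautInstance (A ⇔ B)
separated⇒¬TautInstance v A-false B-true taut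
  with () ← trans (sym (cong₂ _⇔ᵇ_ A-false B-true)) (taut v)

proposition2p2 : Nontrivial A-M8 A-t
proposition2p2 (_ , ρ , y , y-injective , y-fresh , σ , σ-spec , taut) =
  let s , s≢a , σA-M8-false = A-M8-instance-refutable σ
        (apart (# 1) (# 0) λ ()) (apart (# 2) (# 0) λ ()) (apart (# 3) (# 2) λ ())
  in separated⇒¬TautInstance {substF σ A-M8} {A-t} (trueExcept s s)
       σA-M8-false (A-t-holds-off-a s≢a s≢a) taut
  where
  σ-injective : Injective _≡_ _≡_ (σ ∘ lookup (nv A-M8))
  σ-injective = injective-via-permutation ρ _ _ σ-spec
    (target-injective y y-injective (λ j j<n∸3 → proj₂ (y-fresh j j<n∸3)))
  apart : ∀ i j → i ≢ j → σ (lookup (nv A-M8) i) ≢ σ (lookup (nv A-M8) j)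
  apart i j i≢j = i≢j ∘ σ-injective
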